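{- Let $X$ be an orientable map with transition matrix $U$. If $U^\tau\hat N=\hat N$ and $U^\tau\hat M=\hat M$ for some integer $\tau>0$, then $U^\tau=I$.
   Context: An orientable map $X$ is a 2-cell embedding of a finite connected multigraph (loops and parallel edges allowed) in a closed orientable surface, with vertex set $V$ and face set $F$. Each edge gives two arcs on opposite sides of it, pointing in opposite directions, each lying in a face and oriented along its clockwise facial walk. Let $\mathcal A$ be the arc set, $v(a)$ the tail vertex and $f(a)$ the face of arc $a$; $N\in\{0,1\}^{\mathcal A\times V}$ with $N(a,w)=1$ iff $w=v(a)$; $M\in\{0,1\}^{\mathcal A\times F}$ with $M(a,f)=1$ iff $f=f(a)$; $D=N^TN$, $\Delta=M^TM$; $\hat N=ND^{ -1/2}$, $\hat M=M\Delta^{ -1/2}$, $Q=\hat N\hat N^T$, $P=\hat M\hat M^T$; $U=(2P-I)(2Q-I)$. -}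

module Defs where

open import Data.Nat using (ℕ; zero; suc)
open import Data.Fin using (Fin; zero; suc)
open import Data.Fin.Permutation using (Permutation′; _⟨$⟩ʳ_)
open import Data.Rational using (ℚ; 0ℚ; 1ℚ; _+_; _*_; _-_; 1/_; ≢-nonZero)
open import Data.Rational.Properties using (_≟_)
open import Data.Product using (∃; Σ; _×_)
open import Function.Bundles using (_⇔_)
open import Relation.Binary.PropositionalEquality using (_≡_; _≢_)
open import Relation.Nullary using (yes; no)
open import Data.Fin using () renaming (_≟_ to _≟ᶠ_)

iter : {A : Set} → ℕ → (A → A) → A → A
iter zero    g x = x
iter (suc k) g x = g (iter k g x)

-- Reflexive-transitive closure under two functions (used for connectivity
-- of the group generated by two permutations of a finite set; forward
-- closure suffices since inverses are positive powers).
data Reach {A : Set} (g h : A → A) (a : A) : A → Set where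
  here  : Reach g h a a
  stepg : ∀ {b} → Reach g h a b → Reach g h a (g b)
  steph : ∀ {b} → Reach g h a b → Reach g h a (h b)

-- Arcs (= darts) are Fin nA.  σ rotates arcs around their tail vertex,
-- α sends an arc to the opposite arc of the same edge (fixed-point-free
-- involution), and φ = σ ∘ α traces facial walks.  Vertices are the
-- σ-orbits, faces are the φ-orbits; v and f are labelings of those orbits
-- by Fin nV and Fin nF.
-- This is the standard equivalence between orientable maps (2-cell
-- embeddings of connected multigraphs in closed orientable surfaces) and
-- transitive pairs (σ, α) with α a fixed-point-free involution.

record OrientableMap : Set where
  field
    nA nV nF  : ℕ
    σ α       : Permutation′ nA
    α-invol   : ∀ a → α ⟨$⟩ʳ (α ⟨$⟩ʳ a) ≡ a
    α-fpf     : ∀ a → α ⟨$⟩ʳ a ≢ a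
    connected : ∀ a b → Reach (σ ⟨$⟩ʳ_) (α ⟨$⟩ʳ_) a b
    v         : Fin nA → Fin nV
    f         : Fin nA → Fin nF
    v-surj    : ∀ w → ∃ λ a → v a ≡ w
    f-surj    : ∀ x → ∃ λ a → f a ≡ x
    v-orbits  : ∀ a b → (v a ≡ v b) ⇔ (∃ λ k → iter k (σ ⟨$⟩ʳ_) a ≡ b)
    f-orbits  : ∀ a b → (f a ≡ f b) ⇔
                  (∃ λ k → iter k (λ c → σ ⟨$⟩ʳ (α ⟨$⟩ʳ c)) a ≡ b)

Mat : ℕ → ℕ → Set
Mat m n = Fin m → Fin n → ℚ

∑ : ∀ {n} → (Fin n → ℚ) → ℚ
∑ {zero}  g = 0ℚ
∑ {suc n} g = g zero + ∑ (λ i → g (suc i))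

infixl 7 _·_
_·_ : ∀ {m n p} → Mat m n → Mat n p → Mat m p
(A · B) i k = ∑ (λ j → A i j * B j k)

transpose : ∀ {m n} → Mat m n → Mat n m
transpose A i j = A j i

idM : ∀ {n} → Mat n n
idM i j with i ≟ᶠ j
... | yes _ = 1ℚ
... | no  _ = 0ℚ

twoMinusI : ∀ {n} → Mat n n → Mat n n
twoMinusI A i j = (A i j + A i j) - idM i j

_^ᴹ_ : ∀ {n} → Mat n n → ℕ → Mat n n
A ^ᴹ zero  = idM
A ^ᴹ suc k = A · (A ^ᴹ k)

-- total inverse on ℚ (only ever applied to nonzero entries below)
qinv : ℚ → ℚ
qinv p with p ≟ 0ℚ
... | yes _  = 0ℚ
... | no p≢0 = 1/_ p {{≢-nonZero p≢0}}

diagInv : ∀ {n} → Mat n n → Mat n n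
diagInv A i j with i ≟ᶠ j
... | yes _ = qinv (A i i)
... | no  _ = 0ℚ

incidence : ∀ {m n} → (Fin m → Fin n) → Mat m n
incidence g a w with g a ≟ᶠ w
... | yes _ = 1ℚ
... | no  _ = 0ℚ

module MapMatrices (X : OrientableMap) where
  open OrientableMap X

  N : Mat nA nV
  N = incidence v

  M : Mat nA nF
  M = incidence f

  D : Mat nV nV
  D = transpose N · N

  Δ : Mat nF nF
  Δ = transpose M · M

  -- Q = N̂ N̂ᵀ = N D^{-1/2} D^{-1/2} Nᵀ = N D⁻¹ Nᵀ
  Q : Mat nA nA
  Q = N · diagInv D · transpose N

  -- P = M̂ M̂ᵀ = M Δ⁻¹ Mᵀ
  P : Mat nA nA
  P = M · diagInv Δ · transpose M

  U : Mat nA nA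
  U = twoMinusI P · twoMinusI Q

-- U is a product of two reflections 2P − I and 2Q − I, where P and Q are the orthogonal
-- projections onto the column spaces of M and N; hence U and V = U^τ are orthogonal.
-- If V fixes the columns of N and M, so does Vᵀ = V⁻¹, so those columns are orthogonal to
-- the range of K = V − I.  Both projections then kill K, both reflections act on it as −1,
-- and U K = K, so V K = K.  Finally Kᵀ K = Vᵀ K − K = Vᵀ V K − K = 0, which forces K = 0.
module Submission where

open import Defs
open import Algebra.Bundles using (Ring)
open import Data.Nat using (ℕ; zero; suc; _<_)
open import Data.Fin using (Fin; zero; suc; punchIn) renaming (_≟_ to _≟ᶠ_)
open import Data.Fin.Properties using (punchInᵢ≢i)
open import Data.Product using (∃; _,_)
open import Data.Rational using (ℚ; 0ℚ; 1ℚ; _+_; _*_; _-_; -_; _≤_; 1/_; nonNegative; nonPositive; ≢-nonZero)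
open import Data.Rational.Properties
  using ( _≟_; ≤-refl; ≤-reflexive; ≤-trans; ≤-antisym; ≤-total; +-mono-≤; +-monoʳ-≤
        ; +-identityʳ; +-inverseʳ; neg-distrib-+; *-comm; *-assoc; *-identityˡ; *-identityʳ; *-zeroˡ; *-zeroʳ
        ; *-inverseʳ; 1≢0; nonNegative⁻¹; nonNeg*nonNeg⇒nonNeg; nonPos*nonPos⇒nonPos
        ; +-*-ring; +-0-group )
open import Data.Rational.Solver using (module +-*-Solver)
open import Data.Sum using (inj₁; inj₂)
open import Data.Empty using (⊥-elim)
open import Function using (_∘_; case_of_)
open import Relation.Binary.Bundles using (Setoid)
open import Relation.Nullary using (yes; no)
open import Relation.Binary.PropositionalEquality
import Relation.Binary.Reasoning.Setoid as SetoidReasoning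
import Algebra.Properties.Semiring.Sum as SemiringSum
open import Algebra.Properties.Group +-0-group using (⁻¹-involutive; x∙y⁻¹≈ε⇒x≈y)
open +-*-Solver

module Sum = SemiringSum (Ring.semiring +-*-ring)
open Sum using (sum)

-- ∑ from Defs is not definitionally the library's sum, so its lemmas are transported along this.
∑≡sum : ∀ {n} (f : Fin n → ℚ) → ∑ f ≡ sum f
∑≡sum {zero}  f = refl
∑≡sum {suc n} f = cong (f zero +_) (∑≡sum (f ∘ suc))

∑-cong : ∀ {n} {f g : Fin n → ℚ} → (∀ i → f i ≡ g i) → ∑ f ≡ ∑ g
∑-cong {f = f} {g} f≗g = trans (∑≡sum f) (trans (Sum.sum-cong-≗ f≗g) (sym (∑≡sum g)))

∑-zero : ∀ n → ∑ {n} (λ _ → 0ℚ) ≡ 0ℚ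
∑-zero n = trans (∑≡sum {n} (λ _ → 0ℚ)) (Sum.sum-replicate-zero n)

∑-distrib-+ : ∀ {n} (f g : Fin n → ℚ) → ∑ (λ i → f i + g i) ≡ ∑ f + ∑ g
∑-distrib-+ f g =
  trans (∑≡sum (λ i → f i + g i)) (trans (Sum.∑-distrib-+ f g) (sym (cong₂ _+_ (∑≡sum f) (∑≡sum g))))

∑-neg : ∀ {n} (f : Fin n → ℚ) → ∑ (λ i → - f i) ≡ - ∑ f
∑-neg {zero}  f = refl
∑-neg {suc n} f = trans (cong (- f zero +_) (∑-neg (f ∘ suc))) (sym (neg-distrib-+ (f zero) _))

∑-distrib-- : ∀ {n} (f g : Fin n → ℚ) → ∑ (λ i → f i - g i) ≡ ∑ f - ∑ g
∑-distrib-- f g = trans (∑-distrib-+ f (λ i → - g i)) (cong (∑ f +_) (∑-neg g))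

*-distribˡ-∑ : ∀ {n} c (f : Fin n → ℚ) → c * ∑ f ≡ ∑ (λ i → c * f i)
*-distribˡ-∑ c f = trans (cong (c *_) (∑≡sum f)) (trans (Sum.*-distribˡ-sum c f) (sym (∑≡sum (λ i → c * f i))))

*-distribʳ-∑ : ∀ {n} c (f : Fin n → ℚ) → ∑ f * c ≡ ∑ (λ i → f i * c)
*-distribʳ-∑ c f = trans (cong (_* c) (∑≡sum f)) (trans (Sum.*-distribʳ-sum c f) (sym (∑≡sum (λ i → f i * c))))

∑-comm : ∀ {m n} (f : Fin m → Fin n → ℚ) → ∑ (λ i → ∑ (f i)) ≡ ∑ (λ j → ∑ (λ i → f i j))
∑-comm f = trans (∑²≡sum² f) (trans (Sum.∑-comm f) (sym (∑²≡sum² (λ j i → f i j))))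
  where
  ∑²≡sum² : ∀ {m n} (g : Fin m → Fin n → ℚ) → ∑ (λ i → ∑ (g i)) ≡ sum (λ i → sum (g i))
  ∑²≡sum² g = trans (∑≡sum (λ i → ∑ (g i))) (Sum.sum-cong-≗ (λ i → ∑≡sum (g i)))

∑-remove : ∀ {n} (f : Fin (suc n) → ℚ) i → ∑ f ≡ f i + sum (f ∘ punchIn i)
∑-remove f i = trans (∑≡sum f) (Sum.sum-remove f)

∑-single : ∀ {n} (f : Fin n → ℚ) i → (∀ j → j ≢ i → f j ≡ 0ℚ) → ∑ f ≡ f i
∑-single {suc n} f i f≡0 = begin
  ∑ f                        ≡⟨ ∑-remove f i ⟩
  f i + sum (f ∘ punchIn i)  ≡⟨ cong (f i +_) (Sum.sum-cong-≗ {x = f ∘ punchIn i} {y = λ _ → 0ℚ} rest≡0) ⟩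
  f i + sum {n} (λ _ → 0ℚ)   ≡⟨ cong (f i +_) (Sum.sum-replicate-zero n) ⟩
  f i + 0ℚ                   ≡⟨ +-identityʳ (f i) ⟩
  f i                        ∎
  where
  open ≡-Reasoning
  rest≡0 : ∀ j → f (punchIn i j) ≡ 0ℚ
  rest≡0 j = f≡0 (punchIn i j) (punchInᵢ≢i i j)

idM-diag : ∀ {n} (i : Fin n) → idM i i ≡ 1ℚ
idM-diag i with i ≟ᶠ i
... | yes _   = refl
... | no  i≢i = ⊥-elim (i≢i refl)

idM-offdiag : ∀ {n} {i j : Fin n} → i ≢ j → idM i j ≡ 0ℚ
idM-offdiag {i = i} {j} i≢j with i ≟ᶠ j
... | yes i≡j = ⊥-elim (i≢j i≡j)
... | no  _   = refl

idM-sym : ∀ {n} (i j : Fin n) → idM i j ≡ idM j i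
idM-sym i j with i ≟ᶠ j | j ≟ᶠ i
... | yes _   | yes _   = refl
... | no  _   | no  _   = refl
... | yes i≡j | no  j≢i = ⊥-elim (j≢i (sym i≡j))
... | no  i≢j | yes j≡i = ⊥-elim (i≢j (sym j≡i))

∑-δˡ : ∀ {n} (i : Fin n) (f : Fin n → ℚ) → ∑ (λ j → idM i j * f j) ≡ f i
∑-δˡ i f = begin
  ∑ (λ j → idM i j * f j)  ≡⟨ ∑-single _ i (λ j j≢i → trans (cong (_* f j) (idM-offdiag (j≢i ∘ sym))) (*-zeroˡ (f j))) ⟩
  idM i i * f i            ≡⟨ cong (_* f i) (idM-diag i) ⟩
  1ℚ * f i                 ≡⟨ *-identityˡ (f i) ⟩
  f i                      ∎
  where open ≡-Reasoning

∑-δʳ : ∀ {n} (i : Fin n) (f : Fin n → ℚ) → ∑ (λ j → f j * idM j i) ≡ f i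
∑-δʳ i f = trans (∑-cong (λ j → trans (*-comm (f j) _) (cong (_* f j) (idM-sym j i)))) (∑-δˡ i f)

square-nonneg : ∀ x → 0ℚ ≤ x * x
square-nonneg x with ≤-total 0ℚ x
... | inj₁ 0≤x = nonNegative⁻¹ (x * x) {{nonNeg*nonNeg⇒nonNeg x {{nonNegative 0≤x}} x {{nonNegative 0≤x}}}}
... | inj₂ x≤0 = nonNegative⁻¹ (x * x) {{nonPos*nonPos⇒nonPos x {{nonPositive x≤0}} x {{nonPositive x≤0}}}}

square≡0⇒≡0 : ∀ x → x * x ≡ 0ℚ → x ≡ 0ℚ
square≡0⇒≡0 x x²≡0 with x ≟ 0ℚ
... | yes x≡0 = x≡0
... | no  x≢0 = ⊥-elim (x≢0 (begin
    x                        ≡⟨ sym (*-identityʳ x) ⟩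
    x * 1ℚ                   ≡⟨ cong (x *_) (sym (*-inverseʳ x)) ⟩
    x * (x * 1/ x)           ≡⟨ sym (*-assoc x x _) ⟩
    x * x * 1/ x             ≡⟨ cong (_* 1/ x) x²≡0 ⟩
    0ℚ * 1/ x                ≡⟨ *-zeroˡ (1/ x) ⟩
    0ℚ                       ∎))
  where
  open ≡-Reasoning
  instance _ = ≢-nonZero x≢0

sum-nonneg : ∀ {n} (f : Fin n → ℚ) → (∀ i → 0ℚ ≤ f i) → 0ℚ ≤ sum f
sum-nonneg {zero}  f _   = ≤-refl
sum-nonneg {suc n} f f≥0 = +-mono-≤ (f≥0 zero) (sum-nonneg (f ∘ suc) (f≥0 ∘ suc))

nonneg+nonneg≡0⇒≡0 : ∀ {p q} → 0ℚ ≤ p → 0ℚ ≤ q → p + q ≡ 0ℚ → p ≡ 0ℚ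
nonneg+nonneg≡0⇒≡0 {p} 0≤p 0≤q p+q≡0 =
  ≤-antisym (≤-trans (≤-reflexive (sym (+-identityʳ p))) (≤-trans (+-monoʳ-≤ p 0≤q) (≤-reflexive p+q≡0))) 0≤p

∑-nonneg≡0⇒≡0 : ∀ {n} (f : Fin n → ℚ) → (∀ i → 0ℚ ≤ f i) → ∑ f ≡ 0ℚ → ∀ i → f i ≡ 0ℚ
∑-nonneg≡0⇒≡0 {suc n} f f≥0 ∑f≡0 i =
  nonneg+nonneg≡0⇒≡0 (f≥0 i) (sum-nonneg _ (f≥0 ∘ punchIn i)) (trans (sym (∑-remove f i)) ∑f≡0)

∑-squares≡0⇒≡0 : ∀ {n} (f : Fin n → ℚ) → ∑ (λ i → f i * f i) ≡ 0ℚ → ∀ i → f i ≡ 0ℚ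
∑-squares≡0⇒≡0 f ∑f²≡0 i =
  square≡0⇒≡0 (f i) (∑-nonneg≡0⇒≡0 (λ i → f i * f i) (λ i → square-nonneg (f i)) ∑f²≡0 i)

infix 4 _≈_
_≈_ : ∀ {m n} → Mat m n → Mat m n → Set
A ≈ B = ∀ i j → A i j ≡ B i j

Mat-setoid : ℕ → ℕ → Setoid _ _
Mat-setoid m n = record
  { Carrier       = Mat m n
  ; _≈_           = _≈_
  ; isEquivalence = record
    { refl  = λ _ _ → refl
    ; sym   = λ A≈B i j → sym (A≈B i j)
    ; trans = λ A≈B B≈C i j → trans (A≈B i j) (B≈C i j)
    }
  }

module ≈-Reasoning {m n} = SetoidReasoning (Mat-setoid m n)

module _ {m n : ℕ} where
  open Setoid (Mat-setoid m n) public using () renaming (refl to ≈-refl; sym to ≈-sym; trans to ≈-trans)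

infixl 6 _⊕_ _⊖_
_⊕_ _⊖_ : ∀ {m n} → Mat m n → Mat m n → Mat m n
(A ⊕ B) i j = A i j + B i j
(A ⊖ B) i j = A i j - B i j

⊝_ : ∀ {m n} → Mat m n → Mat m n
(⊝ A) i j = - A i j

0M : ∀ {m n} → Mat m n
0M _ _ = 0ℚ

⊖-cong : ∀ {m n} {A A′ B B′ : Mat m n} → A ≈ A′ → B ≈ B′ → A ⊖ B ≈ A′ ⊖ B′
⊖-cong A≈A′ B≈B′ i j = cong₂ _-_ (A≈A′ i j) (B≈B′ i j)

⊖-self : ∀ {m n} (A : Mat m n) → A ⊖ A ≈ 0M
⊖-self A i j = +-inverseʳ (A i j)

⊖≈0⇒≈ : ∀ {m n} {A B : Mat m n} → A ⊖ B ≈ 0M → A ≈ B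
⊖≈0⇒≈ A⊖B≈0 i j = x∙y⁻¹≈ε⇒x≈y _ _ (A⊖B≈0 i j)

transpose-idM : ∀ {n} → transpose (idM {n}) ≈ idM
transpose-idM i j = idM-sym j i

·-cong : ∀ {m n p} {A A′ : Mat m n} {B B′ : Mat n p} → A ≈ A′ → B ≈ B′ → A · B ≈ A′ · B′
·-cong A≈A′ B≈B′ i k = ∑-cong (λ j → cong₂ _*_ (A≈A′ i j) (B≈B′ j k))

·-congˡ : ∀ {m n p} (A : Mat m n) {B B′ : Mat n p} → B ≈ B′ → A · B ≈ A · B′
·-congˡ A = ·-cong {A = A} ≈-refl

·-congʳ : ∀ {m n p} {A A′ : Mat m n} (B : Mat n p) → A ≈ A′ → A · B ≈ A′ · B
·-congʳ B A≈A′ = ·-cong {B = B} A≈A′ ≈-refl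

·-assoc : ∀ {m n p q} (A : Mat m n) (B : Mat n p) (C : Mat p q) → (A · B) · C ≈ A · (B · C)
·-assoc A B C i l = begin
  ∑ (λ j → ∑ (λ k → A i k * B k j) * C j l)  ≡⟨ ∑-cong (λ j → *-distribʳ-∑ (C j l) (λ k → A i k * B k j)) ⟩
  ∑ (λ j → ∑ (λ k → A i k * B k j * C j l))  ≡⟨ ∑-comm (λ j k → A i k * B k j * C j l) ⟩
  ∑ (λ k → ∑ (λ j → A i k * B k j * C j l))  ≡⟨ ∑-cong (λ k → ∑-cong (λ j → *-assoc (A i k) (B k j) (C j l))) ⟩
  ∑ (λ k → ∑ (λ j → A i k * (B k j * C j l))) ≡⟨ ∑-cong (λ k → sym (*-distribˡ-∑ (A i k) (λ j → B k j * C j l))) ⟩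
  ∑ (λ k → A i k * ∑ (λ j → B k j * C j l))  ∎
  where open ≡-Reasoning

·-identityˡ : ∀ {m n} (A : Mat m n) → idM · A ≈ A
·-identityˡ A i j = ∑-δˡ i (λ k → A k j)

·-identityʳ : ∀ {m n} (A : Mat m n) → A · idM ≈ A
·-identityʳ A i j = ∑-δʳ j (A i)

·-zeroʳ : ∀ {m n p} (A : Mat m n) → A · 0M {n} {p} ≈ 0M
·-zeroʳ {n = n} A i j = trans (∑-cong (λ k → *-zeroʳ (A i k))) (∑-zero n)

·-negʳ : ∀ {m n p} (A : Mat m n) (B : Mat n p) → A · (⊝ B) ≈ ⊝ (A · B)
·-negʳ A B i j = trans (∑-cong (λ k → solve 2 (λ a b → a :* (:- b) := :- (a :* b)) refl (A i k) (B k j))) (∑-neg (λ k → A i k * B k j))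

·-distribʳ-⊕ : ∀ {m n p} (A B : Mat m n) (C : Mat n p) → (A ⊕ B) · C ≈ A · C ⊕ B · C
·-distribʳ-⊕ A B C i k =
  trans (∑-cong (λ j → solve 3 (λ a b c → (a :+ b) :* c := a :* c :+ b :* c) refl (A i j) (B i j) (C j k)))
        (∑-distrib-+ (λ j → A i j * C j k) (λ j → B i j * C j k))

·-distribʳ-⊖ : ∀ {m n p} (A B : Mat m n) (C : Mat n p) → (A ⊖ B) · C ≈ A · C ⊖ B · C
·-distribʳ-⊖ A B C i k =
  trans (∑-cong (λ j → solve 3 (λ a b c → (a :- b) :* c := a :* c :- b :* c) refl (A i j) (B i j) (C j k)))
        (∑-distrib-- (λ j → A i j * C j k) (λ j → B i j * C j k))

·-distribˡ-⊕ : ∀ {m n p} (C : Mat m n) (A B : Mat n p) → C · (A ⊕ B) ≈ C · A ⊕ C · B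
·-distribˡ-⊕ C A B i k =
  trans (∑-cong (λ j → solve 3 (λ c a b → c :* (a :+ b) := c :* a :+ c :* b) refl (C i j) (A j k) (B j k)))
        (∑-distrib-+ (λ j → C i j * A j k) (λ j → C i j * B j k))

·-distribˡ-⊖ : ∀ {m n p} (C : Mat m n) (A B : Mat n p) → C · (A ⊖ B) ≈ C · A ⊖ C · B
·-distribˡ-⊖ C A B i k =
  trans (∑-cong (λ j → solve 3 (λ c a b → c :* (a :- b) := c :* a :- c :* b) refl (C i j) (A j k) (B j k)))
        (∑-distrib-- (λ j → C i j * A j k) (λ j → C i j * B j k))

transpose-· : ∀ {m n p} (A : Mat m n) (B : Mat n p) → transpose (A · B) ≈ transpose B · transpose A
transpose-· A B i j = ∑-cong (λ k → *-comm (A j k) (B k i))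

Symmetric : ∀ {n} → Mat n n → Set
Symmetric A = transpose A ≈ A

Idempotent : ∀ {n} → Mat n n → Set
Idempotent A = A · A ≈ A

Orthogonal : ∀ {n} → Mat n n → Set
Orthogonal A = transpose A · A ≈ idM

orthogonal-idM : ∀ {n} → Orthogonal (idM {n})
orthogonal-idM = ≈-trans (·-identityʳ (transpose idM)) transpose-idM

orthogonal-· : ∀ {n} {A B : Mat n n} → Orthogonal A → Orthogonal B → Orthogonal (A · B)
orthogonal-· {A = A} {B} AᵀA≈I BᵀB≈I = begin
  transpose (A · B) · (A · B)            ≈⟨ ·-congʳ (A · B) (transpose-· A B) ⟩
  (transpose B · transpose A) · (A · B)  ≈⟨ ·-assoc (transpose B) (transpose A) (A · B) ⟩
  transpose B · (transpose A · (A · B))  ≈⟨ ·-congˡ (transpose B) (≈-sym (·-assoc (transpose A) A B)) ⟩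
  transpose B · ((transpose A · A) · B)  ≈⟨ ·-congˡ (transpose B) (·-congʳ B AᵀA≈I) ⟩
  transpose B · (idM · B)                ≈⟨ ·-congˡ (transpose B) (·-identityˡ B) ⟩
  transpose B · B                        ≈⟨ BᵀB≈I ⟩
  idM                                    ∎
  where open ≈-Reasoning

orthogonal-^ : ∀ {n} {A : Mat n n} → Orthogonal A → ∀ k → Orthogonal (A ^ᴹ k)
orthogonal-^ _      zero    = orthogonal-idM
orthogonal-^ {A = A} orthoA (suc k) = orthogonal-· {A = A} {A ^ᴹ k} orthoA (orthogonal-^ orthoA k)

^ᴹ-fix : ∀ {n p} {A : Mat n n} {B : Mat n p} → A · B ≈ B → ∀ k → (A ^ᴹ k) · B ≈ B
^ᴹ-fix {B = B} AB≈B zero = ·-identityˡ B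
^ᴹ-fix {A = A} {B} AB≈B (suc k) =
  ≈-trans (·-assoc A (A ^ᴹ k) B) (≈-trans (·-congˡ A (^ᴹ-fix AB≈B k)) AB≈B)

orthogonal-fixᵀ : ∀ {n p} {V : Mat n n} {B : Mat n p} → Orthogonal V → V · B ≈ B → transpose V · B ≈ B
orthogonal-fixᵀ {V = V} {B} VᵀV≈I VB≈B = begin
  transpose V · B        ≈⟨ ·-congˡ (transpose V) (≈-sym VB≈B) ⟩
  transpose V · (V · B)  ≈⟨ ≈-sym (·-assoc (transpose V) V B) ⟩
  (transpose V · V) · B  ≈⟨ ·-congʳ B VᵀV≈I ⟩
  idM · B                ≈⟨ ·-identityˡ B ⟩
  B                      ∎
  where open ≈-Reasoning

orthogonal-fix⇒Gᵀ·[V⊖I]≈0 : ∀ {n p} {V : Mat n n} {G : Mat n p} →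
  Orthogonal V → V · G ≈ G → transpose G · (V ⊖ idM) ≈ 0M
orthogonal-fix⇒Gᵀ·[V⊖I]≈0 {V = V} {G} VᵀV≈I VG≈G = begin
  transpose G · (V ⊖ idM)                  ≈⟨ ·-distribˡ-⊖ (transpose G) V idM ⟩
  transpose G · V ⊖ transpose G · idM      ≈⟨ ⊖-cong GᵀV≈Gᵀ (·-identityʳ (transpose G)) ⟩
  transpose G ⊖ transpose G                ≈⟨ ⊖-self (transpose G) ⟩
  0M                                       ∎
  where
  open ≈-Reasoning
  GᵀV≈Gᵀ : transpose G · V ≈ transpose G
  GᵀV≈Gᵀ = ≈-trans (≈-sym (transpose-· (transpose V) G))
                   (λ i j → orthogonal-fixᵀ {V = V} VᵀV≈I VG≈G j i)

orthogonal-unipotent⇒≈idM : ∀ {n} {V : Mat n n} → Orthogonal V → V · (V ⊖ idM) ≈ V ⊖ idM → V ≈ idM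
orthogonal-unipotent⇒≈idM {V = V} VᵀV≈I VK≈K = ⊖≈0⇒≈ K≈0
  where
  K = V ⊖ idM
  KᵀK≈0 : transpose K · K ≈ 0M
  KᵀK≈0 = begin
    transpose K · K                ≈⟨ ·-congʳ K (⊖-cong {A = transpose V} ≈-refl transpose-idM) ⟩
    (transpose V ⊖ idM) · K        ≈⟨ ·-distribʳ-⊖ (transpose V) idM K ⟩
    transpose V · K ⊖ idM · K      ≈⟨ ⊖-cong (orthogonal-fixᵀ {V = V} VᵀV≈I VK≈K) (·-identityˡ K) ⟩
    K ⊖ K                          ≈⟨ ⊖-self K ⟩
    0M                             ∎
    where open ≈-Reasoning
  K≈0 : K ≈ 0M
  K≈0 i j = ∑-squares≡0⇒≡0 (λ c → K c j) (KᵀK≈0 j j) i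

twoMinusI-symmetric : ∀ {n} {A : Mat n n} → Symmetric A → Symmetric (twoMinusI A)
twoMinusI-symmetric Aᵀ≈A i j = cong₂ _-_ (cong₂ _+_ (Aᵀ≈A i j) (Aᵀ≈A i j)) (idM-sym j i)

twoMinusI-·ˡ : ∀ {n p} (A : Mat n n) (B : Mat n p) → twoMinusI A · B ≈ (A · B ⊕ A · B) ⊖ B
twoMinusI-·ˡ A B =
  ≈-trans (·-distribʳ-⊖ (A ⊕ A) idM B) (⊖-cong (·-distribʳ-⊕ A A B) (·-identityˡ B))

twoMinusI-·ʳ : ∀ {m n} (B : Mat m n) (A : Mat n n) → B · twoMinusI A ≈ (B · A ⊕ B · A) ⊖ B
twoMinusI-·ʳ B A =
  ≈-trans (·-distribˡ-⊖ B (A ⊕ A) idM) (⊖-cong (·-distribˡ-⊕ B A A) (·-identityʳ B))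

twoMinusI-involutive : ∀ {n} {A : Mat n n} → Idempotent A → twoMinusI A · twoMinusI A ≈ idM
twoMinusI-involutive {A = A} AA≈A i j = begin
  (T · T) i j                                   ≡⟨ twoMinusI-·ˡ A T i j ⟩
  ((A · T) i j + (A · T) i j) - T i j           ≡⟨ cong (λ x → (x + x) - T i j) AT≈A ⟩
  (A i j + A i j) - T i j                       ≡⟨ solve 2 (λ a d → (a :+ a) :- ((a :+ a) :- d) := d) refl (A i j) (idM i j) ⟩
  idM i j                                       ∎
  where
  open ≡-Reasoning
  T = twoMinusI A
  AT≈A : (A · T) i j ≡ A i j
  AT≈A = trans (twoMinusI-·ʳ A A i j)
    (trans (cong (λ x → (x + x) - A i j) (AA≈A i j)) (solve 1 (λ a → (a :+ a) :- a := a) refl (A i j)))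

twoMinusI-orthogonal : ∀ {n} {A : Mat n n} → Symmetric A → Idempotent A → Orthogonal (twoMinusI A)
twoMinusI-orthogonal {A = A} Aᵀ≈A AA≈A =
  ≈-trans (·-congʳ (twoMinusI A) (twoMinusI-symmetric Aᵀ≈A)) (twoMinusI-involutive AA≈A)

twoMinusI-negates : ∀ {n p} {A : Mat n n} {B : Mat n p} → A · B ≈ 0M → twoMinusI A · B ≈ ⊝ B
twoMinusI-negates {A = A} {B} AB≈0 i j =
  trans (twoMinusI-·ˡ A B i j)
    (trans (cong (λ x → (x + x) - B i j) (AB≈0 i j)) (solve 1 (λ b → (con 0ℚ :+ con 0ℚ) :- b := :- b) refl (B i j)))

twoMinusI-product-fixes : ∀ {n p} {A C : Mat n n} {B : Mat n p} →
  A · B ≈ 0M → C · B ≈ 0M → (twoMinusI A · twoMinusI C) · B ≈ B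
twoMinusI-product-fixes {A = A} {C} {B} AB≈0 CB≈0 = begin
  (twoMinusI A · twoMinusI C) · B  ≈⟨ ·-assoc (twoMinusI A) (twoMinusI C) B ⟩
  twoMinusI A · (twoMinusI C · B)  ≈⟨ ·-congˡ (twoMinusI A) (twoMinusI-negates {A = C} CB≈0) ⟩
  twoMinusI A · (⊝ B)              ≈⟨ twoMinusI-negates {A = A} A·⊝B≈0 ⟩
  ⊝ (⊝ B)                          ≈⟨ (λ i j → ⁻¹-involutive (B i j)) ⟩
  B                                ∎
  where
  open ≈-Reasoning
  A·⊝B≈0 : A · (⊝ B) ≈ 0M
  A·⊝B≈0 i j = trans (·-negʳ A B i j) (cong -_ (AB≈0 i j))

diagInv-diag : ∀ {n} (A : Mat n n) i → diagInv A i i ≡ qinv (A i i)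
diagInv-diag A i with i ≟ᶠ i
... | yes _   = refl
... | no  i≢i = ⊥-elim (i≢i refl)

diagInv-offdiag : ∀ {n} (A : Mat n n) {i j} → i ≢ j → diagInv A i j ≡ 0ℚ
diagInv-offdiag A {i} {j} i≢j with i ≟ᶠ j
... | yes i≡j = ⊥-elim (i≢j i≡j)
... | no  _   = refl

diagInv-symmetric : ∀ {n} (A : Mat n n) → Symmetric (diagInv A)
diagInv-symmetric A i j with j ≟ᶠ i | i ≟ᶠ j
... | yes refl | yes _   = refl
... | no  _    | no  _   = refl
... | yes j≡i  | no  i≢j = ⊥-elim (i≢j (sym j≡i))
... | no  j≢i  | yes i≡j = ⊥-elim (j≢i (sym i≡j))

qinv-inverseʳ : ∀ p → p ≢ 0ℚ → p * qinv p ≡ 1ℚ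
qinv-inverseʳ p p≢0 with p ≟ 0ℚ
... | yes p≡0 = ⊥-elim (p≢0 p≡0)
... | no  p≢0 = *-inverseʳ p {{≢-nonZero p≢0}}

diagInv-inverseʳ : ∀ {n} (A : Mat n n) → (∀ i j → i ≢ j → A i j ≡ 0ℚ) → (∀ i → A i i ≢ 0ℚ) →
  A · diagInv A ≈ idM
diagInv-inverseʳ A offdiag≡0 diag≢0 i j =
  trans (∑-single _ j (λ k k≢j → trans (cong (A i k *_) (diagInv-offdiag A k≢j)) (*-zeroʳ (A i k))))
        (entry (i ≟ᶠ j))
  where
  entry : _ → A i j * diagInv A j j ≡ idM i j
  entry (yes refl) = trans (cong (A i i *_) (diagInv-diag A i)) (trans (qinv-inverseʳ _ (diag≢0 i)) (sym (idM-diag i)))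
  entry (no i≢j)   = trans (cong (_* diagInv A j j) (offdiag≡0 i j i≢j)) (trans (*-zeroˡ (diagInv A j j)) (sym (idM-offdiag i≢j)))

projection : ∀ {m n} → Mat m n → Mat m m
projection G = G · diagInv (transpose G · G) · transpose G

projection-symmetric : ∀ {m n} (G : Mat m n) → Symmetric (projection G)
projection-symmetric G = begin
  transpose (G · E · transpose G)      ≈⟨ transpose-· (G · E) (transpose G) ⟩
  G · transpose (G · E)                ≈⟨ ·-congˡ G (transpose-· G E) ⟩
  G · (transpose E · transpose G)      ≈⟨ ·-congˡ G (·-congʳ (transpose G) (diagInv-symmetric (transpose G · G))) ⟩
  G · (E · transpose G)                ≈⟨ ≈-sym (·-assoc G E (transpose G)) ⟩
  G · E · transpose G                  ∎
  where
  open ≈-Reasoning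
  E = diagInv (transpose G · G)

projection-idempotent : ∀ {m n} (G : Mat m n) →
  (transpose G · G) · diagInv (transpose G · G) ≈ idM → Idempotent (projection G)
projection-idempotent G GᵀGE≈I = begin
  GE · transpose G · (GE · transpose G)          ≈⟨ ·-assoc GE (transpose G) (GE · transpose G) ⟩
  GE · (transpose G · (GE · transpose G))        ≈⟨ ·-congˡ GE (≈-sym (·-assoc (transpose G) GE (transpose G))) ⟩
  GE · ((transpose G · GE) · transpose G)        ≈⟨ ·-congˡ GE (·-congʳ (transpose G) (≈-sym (·-assoc (transpose G) G E))) ⟩
  GE · (((transpose G · G) · E) · transpose G)   ≈⟨ ·-congˡ GE (·-congʳ (transpose G) GᵀGE≈I) ⟩
  GE · (idM · transpose G)                       ≈⟨ ·-congˡ GE (·-identityˡ (transpose G)) ⟩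
  GE · transpose G                               ∎
  where
  open ≈-Reasoning
  E = diagInv (transpose G · G)
  GE = G · E

projection-annihilates : ∀ {m n p} (G : Mat m n) {B : Mat m p} → transpose G · B ≈ 0M → projection G · B ≈ 0M
projection-annihilates G {B} GᵀB≈0 =
  ≈-trans (·-assoc GE (transpose G) B) (≈-trans (·-congˡ GE GᵀB≈0) (·-zeroʳ GE))
  where GE = G · diagInv (transpose G · G)

module _ {m n : ℕ} (g : Fin m → Fin n) where
  private
    G = incidence g

  incidence-≡ : ∀ {a w} → g a ≡ w → G a w ≡ 1ℚ
  incidence-≡ {a} {w} ga≡w with g a ≟ᶠ w
  ... | yes _    = refl
  ... | no ga≢w  = ⊥-elim (ga≢w ga≡w)

  incidence-≢ : ∀ {a w} → g a ≢ w → G a w ≡ 0ℚ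
  incidence-≢ {a} {w} ga≢w with g a ≟ᶠ w
  ... | yes ga≡w = ⊥-elim (ga≢w ga≡w)
  ... | no _     = refl

  incidence-gram-offdiag : ∀ w w′ → w ≢ w′ → (transpose G · G) w w′ ≡ 0ℚ
  incidence-gram-offdiag w w′ w≢w′ = trans (∑-cong term≡0) (∑-zero m)
    where
    term≡0 : ∀ a → G a w * G a w′ ≡ 0ℚ
    term≡0 a = case g a ≟ᶠ w of λ where
      (yes ga≡w) → trans (cong (G a w *_) (incidence-≢ (w≢w′ ∘ trans (sym ga≡w)))) (*-zeroʳ (G a w))
      (no  ga≢w) → trans (cong (_* G a w′) (incidence-≢ ga≢w)) (*-zeroˡ (G a w′))

  incidence-gram-diag≢0 : (∀ w → ∃ λ a → g a ≡ w) → ∀ w → (transpose G · G) w w ≢ 0ℚ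
  incidence-gram-diag≢0 surj w gram≡0 with surj w
  ... | a , ga≡w = 1≢0 (trans (sym (incidence-≡ ga≡w)) (∑-squares≡0⇒≡0 (λ a → G a w) gram≡0 a))

  incidence-reflection-orthogonal : (∀ w → ∃ λ a → g a ≡ w) → Orthogonal (twoMinusI (projection G))
  incidence-reflection-orthogonal surj =
    twoMinusI-orthogonal (projection-symmetric G)
      (projection-idempotent G (diagInv-inverseʳ _ incidence-gram-offdiag (incidence-gram-diag≢0 surj)))

lemma5p1 : (X : OrientableMap) → (τ : ℕ) → 0 < τ →
    (∀ a w → ((MapMatrices.U X ^ᴹ τ) · MapMatrices.N X) a w ≡ MapMatrices.N X a w) →
    (∀ a x → ((MapMatrices.U X ^ᴹ τ) · MapMatrices.M X) a x ≡ MapMatrices.M X a x) →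
    ∀ a b → (MapMatrices.U X ^ᴹ τ) a b ≡ idM a b
lemma5p1 X τ _ VN≈N VM≈M = orthogonal-unipotent⇒≈idM {V = V} V-orthogonal (^ᴹ-fix UK≈K τ)
  where
  open OrientableMap X
  open MapMatrices X

  V = U ^ᴹ τ

  V-orthogonal : Orthogonal V
  V-orthogonal = orthogonal-^ {A = U}
    (orthogonal-· {A = twoMinusI P} {twoMinusI Q}
      (incidence-reflection-orthogonal f f-surj) (incidence-reflection-orthogonal v v-surj)) τ

  UK≈K : U · (V ⊖ idM) ≈ V ⊖ idM
  UK≈K = twoMinusI-product-fixes {A = P} {Q}
    (projection-annihilates M (orthogonal-fix⇒Gᵀ·[V⊖I]≈0 {V = V} V-orthogonal VM≈M))
    (projection-annihilates N (orthogonal-fix⇒Gᵀ·[V⊖I]≈0 {V = V} V-orthogonal VN≈N))
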